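{- Let $t$ be a positive integer and define the integer sequence $u_0 = 0$, $u_1 = 1$, $u_{j+2} = t u_{j+1} + u_j$ for $j \geq 0$. (a) There is an injection from the set of terms $u_j$ with $j$ odd that are squares of integers to the set of integer points $(x, y)$ with $x, y \geq 0$ on the curve $C_1 : y^2 = (t^2+4)x^4 - 4$; the point $(x,y)$ corresponds to $u_j = x^2$. (b) Write $t^2 + 4 = d z^2$ with $z$ an integer and $d$ squarefree. There is an injection from the set of terms $u_j$ with $j$ odd such that $u_j / d$ is the square of an integer to the set of integer points $(x, y)$ with $x, y \geq 0$ on the curve $C_2 : y^2 = d^2 (t^2+4) x^4 - 4$; the point $(x, y)$ corresponds to $u_j = d x^2$. (c) If $\omega = (t + \sqrt{t^2+4})/2$ is the fundamental unit of $\mathbb{Q}(\sqrt{t^2+4})$, then the injections in (a) and (b) are bijections. -}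

module Defs where

open import Data.Nat as ℕ using (ℕ; zero; suc)
open import Data.Integer as ℤ using (ℤ; +_; ∣_∣)
open import Data.Rational as ℚ using (ℚ; _/_; 0ℚ; 1ℚ)
open import Data.Nat.Divisibility using (_∣_)
open import Data.Product using (Σ; _×_; _,_; ∃; ∃-syntax; proj₁; proj₂)
open import Data.Sum using (_⊎_)
open import Relation.Binary.PropositionalEquality using (_≡_)

u : ℕ → ℕ → ℕ
u t zero = 0
u t (suc zero) = 1
u t (suc (suc j)) = t ℕ.* u t (suc j) ℕ.+ u t j

SquareFree : ℕ → Set
SquareFree d = ∀ (m : ℕ) → (m ℕ.* m) ∣ d → m ≡ 1

SqTerms : ℕ → Set
SqTerms t = Σ ℤ λ n → (∃[ k ] + u t (suc (2 ℕ.* k)) ≡ n) × (∃[ x ] n ≡ x ℤ.* x)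

D : ℕ → ℤ
D t = + (t ℕ.* t ℕ.+ 4)

C₁Points : ℕ → Set
C₁Points t = Σ (ℤ × ℤ) λ { (x , y) →
  (+ 0 ℤ.≤ x) × (+ 0 ℤ.≤ y) × (y ℤ.* y ≡ D t ℤ.* (x ℤ.* x ℤ.* x ℤ.* x) ℤ.- + 4) }

dSqTerms : ℕ → ℕ → Set
dSqTerms t d = Σ ℤ λ n → (∃[ k ] + u t (suc (2 ℕ.* k)) ≡ n) × (∃[ x ] n ≡ + d ℤ.* (x ℤ.* x))

C₂Points : ℕ → ℕ → Set
C₂Points t d = Σ (ℤ × ℤ) λ { (x , y) →
  (+ 0 ℤ.≤ x) × (+ 0 ℤ.≤ y) ×
  (y ℤ.* y ≡ + d ℤ.* + d ℤ.* D t ℤ.* (x ℤ.* x ℤ.* x ℤ.* x) ℤ.- + 4) }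

-- Injective / surjective maps between such sets; elements are compared
-- by their underlying value (the integer u_j, resp. the point (x,y)).

Injective : {A : Set} {B : Set} {P : A → Set} {Q : B → Set} →
            (Σ A P → Σ B Q) → Set
Injective f = ∀ s s' → proj₁ (f s) ≡ proj₁ (f s') → proj₁ s ≡ proj₁ s'

Surjective : {A : Set} {B : Set} {P : A → Set} {Q : B → Set} →
             (Σ A P → Σ B Q) → Set
Surjective {A} {B} {P} {Q} f = ∀ (p : Σ B Q) → Σ (Σ A P) λ s → proj₁ (f s) ≡ proj₁ p

Corr₁ : (t : ℕ) → (SqTerms t → C₁Points t) → Set
Corr₁ t f = ∀ s → proj₁ s ≡ proj₁ (proj₁ (f s)) ℤ.* proj₁ (proj₁ (f s))

Corr₂ : (t d : ℕ) → (dSqTerms t d → C₂Points t d) → Set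
Corr₂ t d f = ∀ s → proj₁ s ≡ + d ℤ.* (proj₁ (proj₁ (f s)) ℤ.* proj₁ (proj₁ (f s)))

-- The real quadratic field K = ℚ(√d): an element (a , b) stands for a + b√d.

K : Set
K = ℚ × ℚ

module _ (d : ℕ) where

  _·_ : K → K → K
  (a , b) · (c , e) = (a ℚ.* c ℚ.+ (+ d / 1) ℚ.* b ℚ.* e , a ℚ.* e ℚ.+ b ℚ.* c)

  oneK : K
  oneK = (1ℚ , 0ℚ)

  negK : K → K
  negK (a , b) = (ℚ.- a , ℚ.- b)

  powK : K → ℕ → K
  powK ω zero = oneK
  powK ω (suc n) = ω · powK ω n

  IsIntℚ : ℚ → Set
  IsIntℚ q = ∃[ m ] q ≡ m / 1

  -- a + b√d is an algebraic integer iff its minimal polynomial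
  -- X² − 2a X + (a² − d b²) (resp. X − a when b = 0) has integer
  -- coefficients; for d squarefree this is: 2a ∈ ℤ and a² − d b² ∈ ℤ.
  IsAlgInt : K → Set
  IsAlgInt (a , b) = IsIntℚ ((+ 2 / 1) ℚ.* a) × IsIntℚ (a ℚ.* a ℚ.- (+ d / 1) ℚ.* b ℚ.* b)

  IsUnit : K → Set
  IsUnit ε = IsAlgInt ε × ∃[ η ] IsAlgInt η × (ε · η ≡ oneK)

  -- ω is a fundamental unit: a unit such that every unit is ± ω^n, n ∈ ℤ
  -- (ε = ±ω^n for n ≥ 0, or ε · ω^n = ±1, i.e. ε = ±ω^(−n)).
  IsFundamentalUnit : K → Set
  IsFundamentalUnit ω = IsUnit ω × (∀ ε → IsUnit ε → ∃[ n ]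
     ((ε ≡ powK ω n) ⊎ (ε ≡ negK (powK ω n))
       ⊎ (ε · powK ω n ≡ oneK) ⊎ (ε · powK ω n ≡ negK oneK)))

-- ω = (t + √(t²+4))/2 = (t + |z|√d)/2 when t² + 4 = d z²
omega : ℕ → ℤ → K
omega t z = (+ t / 2 , + ∣ z ∣ / 2)

{-# OPTIONS --safe #-}
-- With D = t² + 4 and ω = (t + √D)/2, the companion sequence v (v₀ = 2, v₁ = t) gives
-- ω^n = (v_n + u_n √D)/2, and multiplicativity of the norm gives v_n² − D u_n² = 4(−1)^n.
-- Hence for odd j, u_j = x² (resp. d x²) yields the point (|x|, v_j) on C₁ (resp. C₂), and a map
-- respecting the correspondence is injective since u_j is read off from x.
-- Conversely a point (x, y) with A = x² (resp. d x²) makes ε = (y + A√D)/2 a unit of norm −1;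
-- if ω is fundamental this forces ε = ω^n with n odd, so A = u_n, and as y ≥ 0 is determined
-- by x the point is the image of that term.
module Submission where

open import Defs
open import Data.Nat using (ℕ; _≤_)
open import Data.Integer using (ℤ; +_; _*_)
open import Data.Product using (_×_; ∃-syntax)
open import Relation.Binary.PropositionalEquality using (_≡_)

open import Data.Nat as ℕ using (zero; suc; z≤n; s≤s; NonZero)
import Data.Nat.Properties as ℕₚ
import Data.Nat.Tactic.RingSolver as ℕ-Solver
open import Data.Integer as ℤ using (-[1+_]; ∣_∣; _+_; _-_; -_; +≤+; 0ℤ)
import Data.Integer.Properties as ℤₚ
import Data.Integer.Tactic.RingSolver as ℤ-Solver
open import Data.Rational as ℚ using (_/_; 0ℚ; toℚᵘ)
import Data.Rational.Properties as ℚₚ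
open import Data.Rational.Unnormalised as ℚᵘ using (mkℚᵘ; *≡*)
import Data.Rational.Unnormalised.Properties as ℚᵘₚ
open import Data.Product using (_,_; proj₁; proj₂)
open import Data.Sum using (inj₁; inj₂)
open import Relation.Binary.Definitions using (tri<; tri≈; tri>)
open import Data.Empty using (⊥; ⊥-elim)
open import Data.List using ([]; _∷_)
open import Relation.Binary.PropositionalEquality using (_≢_; refl; sym; trans; cong; cong₂; subst; subst₂; module ≡-Reasoning)
open import Function using (case_of_)

toℚᵘ-/ : ∀ a m → toℚᵘ (a / suc m) ℚᵘ.≃ mkℚᵘ a m
toℚᵘ-/ a m = ℚₚ.toℚᵘ-fromℚᵘ (mkℚᵘ a m)

cross⇒/≡/ : ∀ a b m n → a * + suc n ≡ b * + suc m → a / suc m ≡ b / suc n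
cross⇒/≡/ a b m n eq = ℚₚ.fromℚᵘ-cong {mkℚᵘ a m} {mkℚᵘ b n} (*≡* eq)

/≡/⇒cross : ∀ a b m n → a / suc m ≡ b / suc n → a * + suc n ≡ b * + suc m
/≡/⇒cross a b m n eq
  with ℚᵘₚ.≃-trans (ℚᵘₚ.≃-sym (toℚᵘ-/ a m)) (ℚᵘₚ.≃-trans (ℚₚ.toℚᵘ-cong eq) (toℚᵘ-/ b n))
... | *≡* cross = cross

*-/ : ∀ a b m n → (a / suc m) ℚ.* (b / suc n) ≡ (a * b) / (suc m ℕ.* suc n)
*-/ a b m n = ℚₚ.toℚᵘ-injective (ℚᵘₚ.≃-trans (ℚₚ.toℚᵘ-homo-* (a / suc m) (b / suc n))
  (ℚᵘₚ.≃-trans (ℚᵘₚ.*-cong (toℚᵘ-/ a m) (toℚᵘ-/ b n)) (ℚᵘₚ.≃-sym (toℚᵘ-/ (a * b) _))))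

neg-/ : ∀ a m → ℚ.- (a / suc m) ≡ (- a) / suc m
neg-/ a m = ℚₚ.toℚᵘ-injective (ℚᵘₚ.≃-trans (ℚₚ.toℚᵘ-homo‿- (a / suc m))
  (ℚᵘₚ.≃-trans (ℚᵘₚ.-‿cong (toℚᵘ-/ a m)) (ℚᵘₚ.≃-sym (toℚᵘ-/ (- a) m))))

/4+/4 : ∀ a b → (a / 4) ℚ.+ (b / 4) ≡ (a + b) / 4
/4+/4 a b = ℚₚ.toℚᵘ-injective (ℚᵘₚ.≃-trans (ℚₚ.toℚᵘ-homo-+ (a / 4) (b / 4))
  (ℚᵘₚ.≃-trans (ℚᵘₚ.+-cong (toℚᵘ-/ a 3) (toℚᵘ-/ b 3))
    (ℚᵘₚ.≃-trans (*≡* (cross a b)) (ℚᵘₚ.≃-sym (toℚᵘ-/ (a + b) 3)))))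
  where
  cross : ∀ a b → (a * + 4 + b * + 4) * + 4 ≡ (a + b) * + 16
  cross = ℤ-Solver.solve-∀

/4≡/2 : ∀ a b → a ≡ + 2 * b → a / 4 ≡ b / 2
/4≡/2 _ b refl = cross⇒/≡/ (+ 2 * b) b 3 1 (ℤ-Solver.solve (b ∷ []))

/4≡0⇒≡0 : ∀ a → a / 4 ≡ 0ℚ → a ≡ 0ℤ
/4≡0⇒≡0 a eq = trans (sym (ℤₚ.*-identityʳ a)) (/≡/⇒cross a 0ℤ 3 0 eq)

half : ℤ → ℤ → K
half a b = (a / 2 , b / 2)

norm : ℤ → ℤ → ℤ → ℤ
norm D a b = a * a - D * (b * b)

half-injective : ∀ a b c e → half a b ≡ half c e → a ≡ c × b ≡ e
half-injective _ _ _ _ eq = cancel (cong proj₁ eq) , cancel (cong proj₂ eq)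
  where
  cancel : ∀ {x y} → x / 2 ≡ y / 2 → x ≡ y
  cancel {x} {y} x/2≡y/2 = ℤₚ.*-cancelʳ-≡ x y (+ 2) (/≡/⇒cross x y 1 1 x/2≡y/2)

module _ (d : ℕ) where

  negK-half : ∀ a b → negK d (half a b) ≡ half (- a) (- b)
  negK-half a b = cong₂ _,_ (neg-/ a 1) (neg-/ b 1)

  half-·-half : ∀ a b c e →
    _·_ d (half a b) (half c e) ≡ ((a * c + + d * b * e) / 4 , (a * e + b * c) / 4)
  half-·-half a b c e = cong₂ _,_
    (trans (cong₂ ℚ._+_ (*-/ a c 1 1) (trans (cong (ℚ._* (e / 2)) (*-/ (+ d) b 0 1)) (*-/ (+ d * b) e 1 1)))
           (/4+/4 (a * c) (+ d * b * e)))
    (trans (cong₂ ℚ._+_ (*-/ a e 1 1) (*-/ b c 1 1)) (/4+/4 (a * e) (b * c)))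

  half-·-half≡half : ∀ a b c e p q → + 2 * p ≡ a * c + + d * b * e → + 2 * q ≡ a * e + b * c →
    _·_ d (half a b) (half c e) ≡ half p q
  half-·-half≡half a b c e p q 2p≡ 2q≡ =
    trans (half-·-half a b c e) (cong₂ _,_ (/4≡/2 _ p (sym 2p≡)) (/4≡/2 _ q (sym 2q≡)))

  half-isAlgInt : ∀ a b m → norm (+ d) a b ≡ + 4 * m → IsAlgInt d (half a b)
  half-isAlgInt a b m N≡4m = (a , trace) , (m , normℚ)
    where
    open ≡-Reasoning
    trace : (+ 2 / 1) ℚ.* (a / 2) ≡ a / 1
    trace = trans (*-/ (+ 2) a 0 1) (cross⇒/≡/ (+ 2 * a) a 1 0 (ℤ-Solver.solve (a ∷ [])))
    normℚ : (a / 2) ℚ.* (a / 2) ℚ.- (+ d / 1) ℚ.* (b / 2) ℚ.* (b / 2) ≡ m / 1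
    normℚ = begin
      (a / 2) ℚ.* (a / 2) ℚ.- (+ d / 1) ℚ.* (b / 2) ℚ.* (b / 2)
        ≡⟨ cong₂ ℚ._-_ (*-/ a a 1 1) (trans (cong (ℚ._* (b / 2)) (*-/ (+ d) b 0 1)) (*-/ (+ d * b) b 1 1)) ⟩
      (a * a) / 4 ℚ.- (+ d * b * b) / 4
        ≡⟨ cong ((a * a) / 4 ℚ.+_) (neg-/ (+ d * b * b) 3) ⟩
      (a * a) / 4 ℚ.+ (- (+ d * b * b)) / 4
        ≡⟨ /4+/4 (a * a) (- (+ d * b * b)) ⟩
      (a * a - + d * b * b) / 4
        ≡⟨ cross⇒/≡/ (a * a - + d * b * b) m 3 0 (begin
             (a * a - + d * b * b) * + 1 ≡⟨ reassociate a b (+ d) ⟩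
             a * a - + d * (b * b)       ≡⟨ N≡4m ⟩
             + 4 * m                     ≡⟨ ℤₚ.*-comm (+ 4) m ⟩
             m * + 4                     ∎) ⟩
      m / 1 ∎
      where
      reassociate : ∀ a b D → (a * a - D * b * b) * + 1 ≡ a * a - D * (b * b)
      reassociate = ℤ-Solver.solve-∀

  half-isUnit : ∀ a b → norm (+ d) a b ≡ - + 4 → IsUnit d (half a b)
  half-isUnit a b N≡-4 =
    half-isAlgInt a b (- + 1) N≡-4 ,
    half (- a) b ,
    half-isAlgInt (- a) b (- + 1) (trans (norm-neg a b (+ d)) N≡-4) ,
    half-·-half≡half a b (- a) b (+ 2) 0ℤ
      (trans (cong -_ (sym N≡-4)) (neg-norm a b (+ d))) (ℤ-Solver.solve (a ∷ b ∷ []))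
    where
    norm-neg : ∀ a b D → - a * - a - D * (b * b) ≡ a * a - D * (b * b)
    norm-neg = ℤ-Solver.solve-∀
    neg-norm : ∀ a b D → - (a * a - D * (b * b)) ≡ a * - a + D * b * b
    neg-norm = ℤ-Solver.solve-∀

record Recurrent (t : ℕ) (x : ℕ → ℕ) : Set where
  constructor recurrent
  field step : ∀ n → x (suc (suc n)) ≡ t ℕ.* x (suc n) ℕ.+ x n

module _ {t : ℕ} where

  recurrent-unique : ∀ {x y} → Recurrent t x → Recurrent t y → x 0 ≡ y 0 → x 1 ≡ y 1 → ∀ n → x n ≡ y n
  recurrent-unique rx ry x0≡y0 x1≡y1 zero = x0≡y0
  recurrent-unique rx ry x0≡y0 x1≡y1 (suc zero) = x1≡y1
  recurrent-unique rx ry x0≡y0 x1≡y1 (suc (suc n)) = trans (Recurrent.step rx n) (trans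
    (cong₂ (λ a b → t ℕ.* a ℕ.+ b)
      (recurrent-unique rx ry x0≡y0 x1≡y1 (suc n)) (recurrent-unique rx ry x0≡y0 x1≡y1 n))
    (sym (Recurrent.step ry n)))

  recurrent-shift : ∀ {x} → Recurrent t x → Recurrent t (λ n → x (suc n))
  recurrent-shift (recurrent step) = recurrent (λ n → step (suc n))

  recurrent-scale : ∀ {x} c → Recurrent t x → Recurrent t (λ n → c ℕ.* x n)
  recurrent-scale {x} c (recurrent step) = recurrent (λ n →
    trans (cong (c ℕ.*_) (step n)) (distrib c t (x (suc n)) (x n)))
    where
    distrib : ∀ c t a b → c ℕ.* (t ℕ.* a ℕ.+ b) ≡ t ℕ.* (c ℕ.* a) ℕ.+ c ℕ.* b
    distrib = ℕ-Solver.solve-∀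

  recurrent-+ : ∀ {x y} → Recurrent t x → Recurrent t y → Recurrent t (λ n → x n ℕ.+ y n)
  recurrent-+ {x} {y} (recurrent stepx) (recurrent stepy) = recurrent (λ n →
    trans (cong₂ ℕ._+_ (stepx n) (stepy n)) (regroup t (x (suc n)) (x n) (y (suc n)) (y n)))
    where
    regroup : ∀ t a b c e → t ℕ.* a ℕ.+ b ℕ.+ (t ℕ.* c ℕ.+ e) ≡ t ℕ.* (a ℕ.+ c) ℕ.+ (b ℕ.+ e)
    regroup = ℕ-Solver.solve-∀

v : ℕ → ℕ → ℕ
v t zero = 2
v t (suc zero) = t
v t (suc (suc j)) = t ℕ.* v t (suc j) ℕ.+ v t j

u-recurrent : ∀ t → Recurrent t (u t)
u-recurrent t = recurrent (λ n → refl)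

v-recurrent : ∀ t → Recurrent t (v t)
v-recurrent t = recurrent (λ n → refl)

2u-suc : ∀ t n → 2 ℕ.* u t (suc n) ≡ t ℕ.* u t n ℕ.+ v t n
2u-suc t = recurrent-unique
  (recurrent-scale 2 (recurrent-shift (u-recurrent t)))
  (recurrent-+ (recurrent-scale t (u-recurrent t)) (v-recurrent t))
  (cong (ℕ._+ 2) (sym (ℕₚ.*-zeroʳ t)))
  (at-1 t)
  where
  at-1 : ∀ t → 2 ℕ.* (t ℕ.* 1 ℕ.+ 0) ≡ t ℕ.* 1 ℕ.+ t
  at-1 = ℕ-Solver.solve-∀

2v-suc : ∀ t n → 2 ℕ.* v t (suc n) ≡ t ℕ.* v t n ℕ.+ (t ℕ.* t ℕ.+ 4) ℕ.* u t n
2v-suc t = recurrent-unique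
  (recurrent-scale 2 (recurrent-shift (v-recurrent t)))
  (recurrent-+ (recurrent-scale t (v-recurrent t)) (recurrent-scale (t ℕ.* t ℕ.+ 4) (u-recurrent t)))
  (at-0 t)
  (at-1 t)
  where
  at-0 : ∀ t → 2 ℕ.* t ≡ t ℕ.* 2 ℕ.+ (t ℕ.* t ℕ.+ 4) ℕ.* 0
  at-0 = ℕ-Solver.solve-∀
  at-1 : ∀ t → 2 ℕ.* (t ℕ.* t ℕ.+ 2) ≡ t ℕ.* t ℕ.+ (t ℕ.* t ℕ.+ 4) ℕ.* 1
  at-1 = ℕ-Solver.solve-∀

D≡t²+4 : ∀ t → D t ≡ + t * + t + + 4
D≡t²+4 t = trans (ℤₚ.pos-+ (t ℕ.* t) 4) (cong (_+ + 4) (ℤₚ.pos-* t t))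

2u-suc-ℤ : ∀ t n → + 2 * + u t (suc n) ≡ + t * + u t n + + v t n
2u-suc-ℤ t n = trans (sym (ℤₚ.pos-* 2 (u t (suc n))))
  (trans (cong +_ (2u-suc t n)) (cong (_+ + v t n) (ℤₚ.pos-* t (u t n))))

2v-suc-ℤ : ∀ t n → + 2 * + v t (suc n) ≡ + t * + v t n + D t * + u t n
2v-suc-ℤ t n = trans (sym (ℤₚ.pos-* 2 (v t (suc n))))
  (trans (cong +_ (2v-suc t n)) (cong₂ _+_ (ℤₚ.pos-* t (v t n)) (ℤₚ.pos-* (t ℕ.* t ℕ.+ 4) (u t n))))

lucasNorm : ℕ → ℕ → ℤ
lucasNorm t n = norm (D t) (+ v t n) (+ u t n)

module _ (t : ℕ) where

  lucasNorm-suc : ∀ n → lucasNorm t (suc n) ≡ - lucasNorm t n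
  lucasNorm-suc n = ℤₚ.*-cancelˡ-≡ (+ 4) _ _ (begin
    + 4 * lucasNorm t (suc n)                   ≡⟨ norm-2· (D t) V′ U′ ⟩
    norm (D t) (+ 2 * V′) (+ 2 * U′)            ≡⟨ cong₂ (norm (D t)) (2v-suc-ℤ t n) (2u-suc-ℤ t n) ⟩
    norm (D t) (T * V + D t * U) (T * U + V)    ≡⟨ norm-· (D t) T V U ⟩
    (T * T - D t) * lucasNorm t n               ≡⟨ cong (_* lucasNorm t n) t²-D≡-4 ⟩
    - + 4 * lucasNorm t n                       ≡⟨ sym (ℤₚ.neg-distribˡ-* (+ 4) _) ⟩
    - (+ 4 * lucasNorm t n)                     ≡⟨ ℤₚ.neg-distribʳ-* (+ 4) _ ⟩
    + 4 * - lucasNorm t n                       ∎)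
    where
    open ≡-Reasoning
    T = + t
    V = + v t n
    U = + u t n
    V′ = + v t (suc n)
    U′ = + u t (suc n)
    norm-2· : ∀ D a b → + 4 * (a * a - D * (b * b)) ≡ + 2 * a * (+ 2 * a) - D * (+ 2 * b * (+ 2 * b))
    norm-2· = ℤ-Solver.solve-∀
    -- multiplicativity of the norm, applied to (t + √D)(v + u√D)
    norm-· : ∀ D t a b → (t * a + D * b) * (t * a + D * b) - D * ((t * b + a) * (t * b + a))
                         ≡ (t * t - D) * (a * a - D * (b * b))
    norm-· = ℤ-Solver.solve-∀
    t²-D≡-4 : T * T - D t ≡ - + 4
    t²-D≡-4 = trans (cong (λ x → T * T - x) (D≡t²+4 t)) (cancel T)
      where
      cancel : ∀ T → T * T - (T * T + + 4) ≡ - + 4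
      cancel = ℤ-Solver.solve-∀

  lucasNorm-0 : lucasNorm t 0 ≡ + 4
  lucasNorm-0 = cong (λ x → + 4 - x) (ℤₚ.*-zeroʳ (D t))

  lucasNorm-2+ : ∀ n → lucasNorm t (suc (suc n)) ≡ lucasNorm t n
  lucasNorm-2+ n = trans (lucasNorm-suc (suc n)) (trans (cong -_ (lucasNorm-suc n)) (ℤₚ.neg-involutive _))

  lucasNorm-odd : ∀ k → lucasNorm t (suc (2 ℕ.* k)) ≡ - + 4
  lucasNorm-odd zero = trans (lucasNorm-suc 0) (cong -_ lucasNorm-0)
  lucasNorm-odd (suc k) = trans (cong (λ n → lucasNorm t (suc n)) (ℕₚ.*-suc 2 k))
                                (trans (lucasNorm-2+ (suc (2 ℕ.* k))) (lucasNorm-odd k))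

  lucasNorm≡-4⇒odd : ∀ n → lucasNorm t n ≡ - + 4 → ∃[ k ] n ≡ suc (2 ℕ.* k)
  lucasNorm≡-4⇒odd zero N≡-4 with trans (sym lucasNorm-0) N≡-4
  ... | ()
  lucasNorm≡-4⇒odd (suc zero) _ = 0 , refl
  lucasNorm≡-4⇒odd (suc (suc n)) N≡-4 with lucasNorm≡-4⇒odd n (trans (sym (lucasNorm-2+ n)) N≡-4)
  ... | k , refl = suc k , cong suc (sym (ℕₚ.*-suc 2 k))

  v-positive : 1 ≤ t → ∀ n → 0 ℕ.< v t n
  v-positive _ zero = s≤s z≤n
  v-positive 1≤t (suc zero) = 1≤t
  v-positive 1≤t (suc (suc n)) = ℕₚ.≤-trans (v-positive 1≤t n) (ℕₚ.m≤n+m _ _)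

norm≡-4⇒curve : ∀ D a b → norm D a b ≡ - + 4 → a * a ≡ D * (b * b) - + 4
norm≡-4⇒curve D a b N≡-4 =
  trans (add-back (a * a) (D * (b * b))) (trans (cong (_+ D * (b * b)) N≡-4) (swap (D * (b * b))))
  where
  add-back : ∀ x y → x ≡ x - y + y
  add-back = ℤ-Solver.solve-∀
  swap : ∀ y → - + 4 + y ≡ y - + 4
  swap = ℤ-Solver.solve-∀

curve⇒norm≡-4 : ∀ D a b → a * a ≡ D * (b * b) - + 4 → norm D a b ≡ - + 4
curve⇒norm≡-4 D a b on-curve = trans (cong (_- D * (b * b)) on-curve) (cancel (D * (b * b)))
  where
  cancel : ∀ y → y - + 4 - y ≡ - + 4
  cancel = ℤ-Solver.solve-∀

D≢0 : ∀ t → D t ≢ 0ℤ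
D≢0 t D≡0 with ℕₚ.m+n≡0⇒n≡0 (t ℕ.* t) (ℤₚ.+-injective D≡0)
... | ()

D-factors-nonZero : ∀ t d Z → D t ≡ + d * (+ Z * + Z) → NonZero d × NonZero Z
D-factors-nonZero t zero Z D≡dZ² = ⊥-elim (D≢0 t (trans D≡dZ² (ℤₚ.*-zeroˡ (+ Z * + Z))))
D-factors-nonZero t (suc d) zero D≡dZ² = ⊥-elim (D≢0 t (trans D≡dZ² (ℤₚ.*-zeroʳ (+ suc d))))
D-factors-nonZero t (suc _) (suc _) _ = _ , _

sq-abs : ∀ x → + ∣ x ∣ * + ∣ x ∣ ≡ x * x
sq-abs (+ _) = refl
sq-abs -[1+ _ ] = refl

square-injectiveℕ : ∀ {m n} → m ℕ.* m ≡ n ℕ.* n → m ≡ n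
square-injectiveℕ {m} {n} m²≡n² with ℕₚ.<-cmp m n
... | tri< m<n _ _ = ⊥-elim (ℕₚ.<-irrefl m²≡n² (ℕₚ.*-mono-< m<n m<n))
... | tri≈ _ m≡n _ = m≡n
... | tri> _ _ n<m = ⊥-elim (ℕₚ.<-irrefl (sym m²≡n²) (ℕₚ.*-mono-< n<m n<m))

nonneg-square-injective : ∀ {a b} → + 0 ℤ.≤ a → + 0 ℤ.≤ b → a * a ≡ b * b → a ≡ b
nonneg-square-injective {+ m} {+ n} _ _ a²≡b² =
  cong +_ (square-injectiveℕ (ℤₚ.+-injective (trans (ℤₚ.pos-* m m) (trans a²≡b² (sym (ℤₚ.pos-* n n))))))

x²-squared : ∀ x → x * x * (x * x) ≡ x * x * x * x
x²-squared = ℤ-Solver.solve-∀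

dx²-squared : ∀ D d x → D * (d * (x * x) * (d * (x * x))) ≡ d * d * D * (x * x * x * x)
dx²-squared = ℤ-Solver.solve-∀

module _ (t : ℕ) where

  odd-term-on-curve : ∀ k →
    + v t (suc (2 ℕ.* k)) * + v t (suc (2 ℕ.* k)) ≡ D t * (+ u t (suc (2 ℕ.* k)) * + u t (suc (2 ℕ.* k))) - + 4
  odd-term-on-curve k = norm≡-4⇒curve (D t) (+ v t (suc (2 ℕ.* k))) (+ u t (suc (2 ℕ.* k))) (lucasNorm-odd t k)

  toC₁ : SqTerms t → C₁Points t
  toC₁ (_ , (k , refl) , (x , u≡x²)) = (+ ∣ x ∣ , + v t (suc (2 ℕ.* k))) , +≤+ z≤n , +≤+ z≤n ,
    trans (odd-term-on-curve k)
      (cong (λ w → D t * w - + 4) (trans (cong (λ w → w * w) (trans u≡x² (sym (sq-abs x)))) (x²-squared (+ ∣ x ∣))))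

  toC₁-corr : Corr₁ t toC₁
  toC₁-corr (_ , (k , refl) , (x , u≡x²)) = trans u≡x² (sym (sq-abs x))

  toC₂ : ∀ d → dSqTerms t d → C₂Points t d
  toC₂ d (_ , (k , refl) , (x , u≡dx²)) = (+ ∣ x ∣ , + v t (suc (2 ℕ.* k))) , +≤+ z≤n , +≤+ z≤n ,
    trans (odd-term-on-curve k)
      (cong (_- + 4) (trans (cong (λ w → D t * (w * w)) (trans u≡dx² (cong (+ d *_) (sym (sq-abs x)))))
                            (dx²-squared (D t) (+ d) (+ ∣ x ∣))))

  toC₂-corr : ∀ d → Corr₂ t d (toC₂ d)
  toC₂-corr d (_ , (k , refl) , (x , u≡dx²)) = trans u≡dx² (cong (+ d *_) (sym (sq-abs x)))

  Corr₁⇒Injective : ∀ f → Corr₁ t f → Injective f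
  Corr₁⇒Injective f corr s s′ fs≡fs′ =
    trans (corr s) (trans (cong (λ p → proj₁ p * proj₁ p) fs≡fs′) (sym (corr s′)))

  Corr₂⇒Injective : ∀ d g → Corr₂ t d g → Injective g
  Corr₂⇒Injective d g corr s s′ gs≡gs′ =
    trans (corr s) (trans (cong (λ p → + d * (proj₁ p * proj₁ p)) gs≡gs′) (sym (corr s′)))

  C₁-point-unique : (p q : C₁Points t) → proj₁ (proj₁ p) ≡ proj₁ (proj₁ q) → proj₁ p ≡ proj₁ q
  C₁-point-unique ((x , y) , _ , 0≤y , on-curve) ((.x , y′) , _ , 0≤y′ , on-curve′) refl =
    cong (x ,_) (nonneg-square-injective 0≤y 0≤y′ (trans on-curve (sym on-curve′)))

  C₂-point-unique : ∀ d → (p q : C₂Points t d) → proj₁ (proj₁ p) ≡ proj₁ (proj₁ q) → proj₁ p ≡ proj₁ q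
  C₂-point-unique d ((x , y) , _ , 0≤y , on-curve) ((.x , y′) , _ , 0≤y′ , on-curve′) refl =
    cong (x ,_) (nonneg-square-injective 0≤y 0≤y′ (trans on-curve (sym on-curve′)))

module _ {t d Z : ℕ} (D≡dZ² : D t ≡ + d * (+ Z * + Z)) where

  instance
    Z-nonZero : NonZero Z
    Z-nonZero = proj₂ (D-factors-nonZero t d Z D≡dZ²)

  ω^n≡half : ∀ n → powK d (half (+ t) (+ Z)) n ≡ half (+ v t n) (+ u t n * + Z)
  ω^n≡half zero = refl
  ω^n≡half (suc n) = trans (cong (_·_ d (half T (+ Z))) (ω^n≡half n))
    (half-·-half≡half d T (+ Z) V (U * + Z) (+ v t (suc n)) (+ u t (suc n) * + Z) 2v′ 2u′Z)
    where
    open ≡-Reasoning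
    T = + t
    V = + v t n
    U = + u t n
    2v′ : + 2 * + v t (suc n) ≡ T * V + + d * + Z * (U * + Z)
    2v′ = begin
      + 2 * + v t (suc n)          ≡⟨ 2v-suc-ℤ t n ⟩
      T * V + D t * U              ≡⟨ cong (λ D → T * V + D * U) D≡dZ² ⟩
      T * V + + d * (+ Z * + Z) * U ≡⟨ regroup T V U (+ d) (+ Z) ⟩
      T * V + + d * + Z * (U * + Z) ∎
      where
      regroup : ∀ T V U d Z → T * V + d * (Z * Z) * U ≡ T * V + d * Z * (U * Z)
      regroup = ℤ-Solver.solve-∀
    2u′Z : + 2 * (+ u t (suc n) * + Z) ≡ T * (U * + Z) + + Z * V
    2u′Z = begin
      + 2 * (+ u t (suc n) * + Z)  ≡⟨ sym (ℤₚ.*-assoc (+ 2) (+ u t (suc n)) (+ Z)) ⟩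
      + 2 * + u t (suc n) * + Z    ≡⟨ cong (_* + Z) (2u-suc-ℤ t n) ⟩
      (T * U + V) * + Z            ≡⟨ regroup T U V (+ Z) ⟩
      T * (U * + Z) + + Z * V      ∎
      where
      regroup : ∀ T U V Z → (T * U + V) * Z ≡ T * (U * Z) + Z * V
      regroup = ℤ-Solver.solve-∀

  -- ε = (Y + A√D)/2 is a unit. It is not −ω^n as Y ≥ 0 > −v_n; it is not ±ω^(−n) since A > 0
  -- makes the √d-part of ε ω^n positive; so ε = ω^n, and its norm −1 forces n to be odd.
  fundamental⇒odd-index : 1 ≤ t → IsFundamentalUnit d (half (+ t) (+ Z)) →
    ∀ A Y → norm (D t) (+ Y) (+ A) ≡ - + 4 → ∃[ k ] u t (suc (2 ℕ.* k)) ≡ A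
  fundamental⇒odd-index 1≤t fundamental A Y N≡-4 = case proj₂ fundamental ε ε-unit of λ where
      (n , inj₁ ε≡ω^n) → odd-index-of-ε≡ω^n n ε≡ω^n
      (n , inj₂ (inj₁ ε≡-ω^n)) → ⊥-elim (ε≢-ω^n n ε≡-ω^n)
      (n , inj₂ (inj₂ (inj₁ εω^n≡1))) → ⊥-elim (εω^n-irrational n (cong proj₂ εω^n≡1))
      (n , inj₂ (inj₂ (inj₂ εω^n≡-1))) → ⊥-elim (εω^n-irrational n (cong proj₂ εω^n≡-1))
    where
    ω ε : K
    ω = half (+ t) (+ Z)
    ε = half (+ Y) (+ A * + Z)

    ε-unit : IsUnit d ε
    ε-unit = half-isUnit d (+ Y) (+ A * + Z)
      (trans (regroup (+ Y) (+ A) (+ d) (+ Z)) (trans (cong (λ D → norm D (+ Y) (+ A)) (sym D≡dZ²)) N≡-4))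
      where
      regroup : ∀ y a d z → y * y - d * (a * z * (a * z)) ≡ y * y - d * (z * z) * (a * a)
      regroup = ℤ-Solver.solve-∀

    odd-index-of-ε≡ω^n : ∀ n → ε ≡ powK d ω n → ∃[ k ] u t (suc (2 ℕ.* k)) ≡ A
    odd-index-of-ε≡ω^n n ε≡ω^n
      with half-injective (+ Y) (+ A * + Z) (+ v t n) (+ u t n * + Z) (trans ε≡ω^n (ω^n≡half n))
    ... | Y≡v , AZ≡uZ
      with A≡u ← ℤₚ.+-injective (ℤₚ.*-cancelʳ-≡ (+ A) (+ u t n) (+ Z) AZ≡uZ)
      with lucasNorm≡-4⇒odd t n (subst₂ (λ y a → norm (D t) y (+ a) ≡ - + 4) Y≡v A≡u N≡-4)
    ... | k , refl = k , sym A≡u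

    ε≢-ω^n : ∀ n → ε ≢ negK d (powK d ω n)
    ε≢-ω^n n ε≡-ω^n =
      +≢-pos (v-positive t 1≤t n) (proj₁ (half-injective (+ Y) (+ A * + Z) (- + v t n) (- (+ u t n * + Z))
        (trans ε≡-ω^n (trans (cong (negK d) (ω^n≡half n)) (negK-half d (+ v t n) (+ u t n * + Z))))))
      where
      +≢-pos : ∀ {m n} → 0 ℕ.< n → + m ≢ - + n
      +≢-pos {n = suc _} _ ()

    εω^n-irrational : ∀ n → proj₂ (_·_ d ε (powK d ω n)) ≡ 0ℚ → ⊥
    εω^n-irrational n εω^n-rational = Y²≢-4 (subst (λ a → norm (D t) (+ Y) (+ a) ≡ - + 4) A≡0 N≡-4)
      where
      V = v t n
      U = u t n
      numerator≡0 : + Y * (+ U * + Z) + + A * + Z * + V ≡ 0ℤ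
      numerator≡0 = /4≡0⇒≡0 _ (trans
        (sym (cong proj₂ (trans (cong (_·_ d ε) (ω^n≡half n))
                                (half-·-half d (+ Y) (+ A * + Z) (+ V) (+ U * + Z)))))
        εω^n-rational)
      AZV≡0 : A ℕ.* Z ℕ.* V ≡ 0
      AZV≡0 = ℕₚ.m+n≡0⇒n≡0 (Y ℕ.* (U ℕ.* Z)) (ℤₚ.+-injective (trans
        (cong₂ _+_ (trans (ℤₚ.pos-* Y (U ℕ.* Z)) (cong (+ Y *_) (ℤₚ.pos-* U Z)))
                   (trans (ℤₚ.pos-* (A ℕ.* Z) V) (cong (_* + V) (ℤₚ.pos-* A Z))))
        numerator≡0))
      A≡0 : A ≡ 0
      A≡0 = ℕₚ.m*n≡0⇒m≡0 A Z (ℕₚ.m*n≡0⇒m≡0 (A ℕ.* Z) V {{ℕ.>-nonZero (v-positive t 1≤t n)}} AZV≡0)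
      Y²≢-4 : norm (D t) (+ Y) (+ 0) ≢ - + 4
      Y²≢-4 N≡-4 with trans (ℤₚ.pos-* Y Y)
                    (trans (sym (trans (cong (λ x → + Y * + Y - x) (ℤₚ.*-zeroʳ (D t))) (ℤₚ.+-identityʳ _))) N≡-4)
      ... | ()

  module _ (1≤t : 1 ≤ t) (fundamental : IsFundamentalUnit d (half (+ t) (+ Z))) where

    Corr₁⇒Surjective : ∀ f → Corr₁ t f → Surjective f
    Corr₁⇒Surjective f corr p@((+ X , + Y) , _ , _ , on-curve) = s , C₁-point-unique t (f s) p x≡X
      where
      open ≡-Reasoning
      on-curve-A : + Y * + Y ≡ D t * (+ (X ℕ.* X) * + (X ℕ.* X)) - + 4
      on-curve-A = begin
        + Y * + Y                                  ≡⟨ on-curve ⟩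
        D t * (+ X * + X * + X * + X) - + 4        ≡⟨ cong (λ w → D t * w - + 4) (sym (x²-squared (+ X))) ⟩
        D t * (+ X * + X * (+ X * + X)) - + 4      ≡⟨ cong (λ w → D t * (w * w) - + 4) (sym (ℤₚ.pos-* X X)) ⟩
        D t * (+ (X ℕ.* X) * + (X ℕ.* X)) - + 4    ∎
      odd-index : ∃[ k ] u t (suc (2 ℕ.* k)) ≡ X ℕ.* X
      odd-index = fundamental⇒odd-index 1≤t fundamental (X ℕ.* X) Y (curve⇒norm≡-4 (D t) (+ Y) (+ (X ℕ.* X)) on-curve-A)
      u≡X² : + u t (suc (2 ℕ.* proj₁ odd-index)) ≡ + X * + X
      u≡X² = trans (cong +_ (proj₂ odd-index)) (ℤₚ.pos-* X X)
      s : SqTerms t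
      s = _ , (proj₁ odd-index , refl) , (+ X , u≡X²)
      x≡X : proj₁ (proj₁ (f s)) ≡ + X
      x≡X = nonneg-square-injective (proj₁ (proj₂ (f s))) (+≤+ z≤n) (trans (sym (corr s)) u≡X²)
    Corr₁⇒Surjective _ _ ((-[1+ _ ] , _) , () , _)
    Corr₁⇒Surjective _ _ ((+ _ , -[1+ _ ]) , _ , () , _)

    Corr₂⇒Surjective : ∀ g → Corr₂ t d g → Surjective g
    Corr₂⇒Surjective g corr p@((+ X , + Y) , _ , _ , on-curve) = s , C₂-point-unique t d (g s) p x≡X
      where
      instance
        d-nonZero : NonZero d
        d-nonZero = proj₁ (D-factors-nonZero t d Z D≡dZ²)
      open ≡-Reasoning
      A = d ℕ.* (X ℕ.* X)
      A≡dX² : + A ≡ + d * (+ X * + X)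
      A≡dX² = trans (ℤₚ.pos-* d (X ℕ.* X)) (cong (+ d *_) (ℤₚ.pos-* X X))
      on-curve-A : + Y * + Y ≡ D t * (+ A * + A) - + 4
      on-curve-A = begin
        + Y * + Y                                                ≡⟨ on-curve ⟩
        + d * + d * D t * (+ X * + X * + X * + X) - + 4          ≡⟨ cong (_- + 4) (sym (dx²-squared (D t) (+ d) (+ X))) ⟩
        D t * (+ d * (+ X * + X) * (+ d * (+ X * + X))) - + 4    ≡⟨ cong (λ w → D t * (w * w) - + 4) (sym A≡dX²) ⟩
        D t * (+ A * + A) - + 4                                  ∎
      odd-index : ∃[ k ] u t (suc (2 ℕ.* k)) ≡ A
      odd-index = fundamental⇒odd-index 1≤t fundamental A Y (curve⇒norm≡-4 (D t) (+ Y) (+ A) on-curve-A)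
      u≡dX² : + u t (suc (2 ℕ.* proj₁ odd-index)) ≡ + d * (+ X * + X)
      u≡dX² = trans (cong +_ (proj₂ odd-index)) A≡dX²
      s : dSqTerms t d
      s = _ , (proj₁ odd-index , refl) , (+ X , u≡dX²)
      x≡X : proj₁ (proj₁ (g s)) ≡ + X
      x≡X = nonneg-square-injective (proj₁ (proj₂ (g s))) (+≤+ z≤n)
              (ℤₚ.*-cancelˡ-≡ (+ d) _ _ (trans (sym (corr s)) u≡dX²))
    Corr₂⇒Surjective _ _ ((-[1+ _ ] , _) , () , _)
    Corr₂⇒Surjective _ _ ((+ _ , -[1+ _ ]) , _ , () , _)

proposition6 : (t : ℕ) → 1 ≤ t →
      (∃[ f ] Corr₁ t f × Injective f)
    × ((d : ℕ) (z : ℤ) → D t ≡ + d * (z * z) → SquareFree d →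
          (∃[ g ] Corr₂ t d g × Injective g)
        × (IsFundamentalUnit d (omega t z) →
             (∀ f → Corr₁ t f → Injective f × Surjective f)
           × (∀ g → Corr₂ t d g → Injective g × Surjective g)))
proposition6 t 1≤t =
    (toC₁ t , toC₁-corr t , Corr₁⇒Injective t (toC₁ t) (toC₁-corr t))
  , λ d z D≡dz² _ →
      let D≡d∣z∣² : D t ≡ + d * (+ ∣ z ∣ * + ∣ z ∣)
          D≡d∣z∣² = trans D≡dz² (cong (+ d *_) (sym (sq-abs z)))
      in
        (toC₂ t d , toC₂-corr t d , Corr₂⇒Injective t d (toC₂ t d) (toC₂-corr t d))
      , λ fundamental →
          (λ f corr → Corr₁⇒Injective t f corr , Corr₁⇒Surjective {Z = ∣ z ∣} D≡d∣z∣² 1≤t fundamental f corr)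
        , (λ g corr → Corr₂⇒Injective t d g corr , Corr₂⇒Surjective {Z = ∣ z ∣} D≡d∣z∣² 1≤t fundamental g corr)
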